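{- Let $K$ be a dp-bi-Kleene algebra (defined in the context). Then for all $x,y,p,q\in K$ the following hold: (a) $\langle x+y\rangle p=\langle x\rangle p+\langle y\rangle p$; (b) $\langle x\cdot y\rangle p=\langle x\rangle\langle y\rangle p$; (c) $\langle d(p)\rangle q=d(p)\cdot d(q)$; (d) $\langle x\| y\rangle p=\langle x\rangle p\cdot\langle y\rangle p$; (e) $d(p)+\langle x\rangle\langle x^\ast\rangle p=\langle x^\ast\rangle p$; (f) if $\langle x\rangle p\le d(p)$ then $\langle x^\ast\rangle p\le d(p)$. In particular, for domain elements $p$ (i.e. $p=d(p)$), these are algebraic forms of the diamond axioms of Peleg's concurrent dynamic logic.
   Context: A proto-dioid is a structure $(S,+,\cdot,0,1_\sigma)$ such that $+$ is associative, commutative and idempotent with unit $0$ (ordered by $x\le y\iff x+y=y$), and $1_\sigma\cdot x=x$, $x\cdot 1_\sigma=x$, $x\cdot y+x\cdot z\le x\cdot(y+z)$, $(x+y)\cdot z=x\cdot z+y\cdot z$, $0\cdot x=0$ (multiplication need not be associative). A proto-trioid $(S,+,\cdot,\|,0,1_\sigma,1_\pi)$ is a proto-dioid $(S,+,\cdot,0,1_\sigma)$ such that $\|$ is associative and commutative with unit $1_\pi$, $x\|(y+z)=x\|y+x\|z$ and $x\|0=0$. A dp-dioid is a proto-dioid with a unary operation $d$ such that $x\cdot(y\cdot z)=(x\cdot y)\cdot z$ whenever one of $x,y,z$ equals $d(w)$ for some $w$, and $x\le d(x)\cdot x$, $d(x\cdot y)=d(x\cdot d(y))$, $d(x+y)=d(x)+d(y)$,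 $d(x)\le 1_\sigma$, $d(0)=0$. A dp-trioid is a dp-dioid which is also a proto-trioid and satisfies $(x\|y)\cdot d(z)=(x\cdot d(z))\|(y\cdot d(z))$, $d(x\|y)=d(x)\cdot d(y)$, $d(x)\|d(y)=d(x)\cdot d(y)$. A dp-Kleene algebra is a dp-dioid with a unary operation $^\ast$ satisfying $1_\sigma+x\cdot x^\ast\le x^\ast$ and $d(z)+x\cdot y\le y\Rightarrow x^\ast\cdot d(z)\le y$. A dp-bi-Kleene algebra is a dp-Kleene algebra which is also a dp-trioid. The diamond is defined by $\langle x\rangle y=d(x\cdot y)$. -}

module Defs where

open import Level using (Level; suc)
open import Relation.Binary.PropositionalEquality using (_≡_)

record DpBiKleeneAlgebra (c : Level) : Set (suc c) where
  infixl 6 _+_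
  infixl 7 _·_
  infixl 5 _∥_
  infix 4 _≤_
  field
    Carrier : Set c
    _+_ _·_ _∥_ : Carrier → Carrier → Carrier
    𝟘 1σ 1π : Carrier
    d : Carrier → Carrier
    _⋆ : Carrier → Carrier

  _≤_ : Carrier → Carrier → Set c
  x ≤ y = x + y ≡ y

  field
    +-assoc : ∀ x y z → (x + y) + z ≡ x + (y + z)
    +-comm : ∀ x y → x + y ≡ y + x
    +-idem : ∀ x → x + x ≡ x
    +-zeroˡ : ∀ x → 𝟘 + x ≡ x
    ·-identityˡ : ∀ x → 1σ · x ≡ x
    ·-identityʳ : ∀ x → x · 1σ ≡ x
    ·-subdistribˡ : ∀ x y z → x · y + x · z ≤ x · (y + z)
    ·-distribʳ : ∀ x y z → (x + y) · z ≡ x · z + y · z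
    ·-zeroˡ : ∀ x → 𝟘 · x ≡ 𝟘
    ∥-assoc : ∀ x y z → (x ∥ y) ∥ z ≡ x ∥ (y ∥ z)
    ∥-comm : ∀ x y → x ∥ y ≡ y ∥ x
    ∥-identityˡ : ∀ x → 1π ∥ x ≡ x
    ∥-distribˡ : ∀ x y z → x ∥ (y + z) ≡ x ∥ y + x ∥ z
    ∥-zeroʳ : ∀ x → x ∥ 𝟘 ≡ 𝟘
    -- dp-dioid: associativity when one argument is a domain element
    ·-assoc-d₁ : ∀ w y z → d w · (y · z) ≡ (d w · y) · z
    ·-assoc-d₂ : ∀ x w z → x · (d w · z) ≡ (x · d w) · z
    ·-assoc-d₃ : ∀ x y w → x · (y · d w) ≡ (x · y) · d w
    d-absorb : ∀ x → x ≤ d x · x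
    d-local : ∀ x y → d (x · y) ≡ d (x · d y)
    d-add : ∀ x y → d (x + y) ≡ d x + d y
    d-sub-id : ∀ x → d x ≤ 1σ
    d-zero : d 𝟘 ≡ 𝟘
    ∥-·-d : ∀ x y z → (x ∥ y) · d z ≡ (x · d z) ∥ (y · d z)
    d-∥ : ∀ x y → d (x ∥ y) ≡ d x · d y
    d-∥-d : ∀ x y → d x ∥ d y ≡ d x · d y
    ⋆-unfold : ∀ x → 1σ + x · (x ⋆) ≤ x ⋆
    ⋆-induct : ∀ x y z → d z + x · y ≤ y → (x ⋆) · d z ≤ y

  ⟨_⟩_ : Carrier → Carrier → Carrier
  ⟨ x ⟩ y = d (x · y)
  infixr 8 ⟨_⟩_

-- Locality d (x · y) = d (x · d y) lets every diamond law be computed on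
-- domain elements, where · associates and agrees with ∥.  The star laws
-- reduce to one induction principle: if d p + ⟨ x ⟩ q ≤ d q, then star
-- induction applied to d q · (x ⋆ · d p) gives x ⋆ · d p ≤ d q · (x ⋆ · d p),
-- so ⟨ x ⋆ ⟩ p ≤ ⟨ d q ⟩ (x ⋆ · d p) ≤ d q.  The unfold law (e) is this
-- principle with q := d p + ⟨ x ⟩ ⟨ x ⋆ ⟩ p, and (f) is it with q := p.
module Submission where

open import Defs
open import Level using (Level)
open import Data.Product using (_×_; _,_)
open import Relation.Binary.PropositionalEquality
  using (_≡_; refl; sym; trans; cong; cong₂; isEquivalence; module ≡-Reasoning)
open import Relation.Binary.Structures using (IsPartialOrder)
open import Relation.Binary.Bundles using (Poset)
import Relation.Binary.Reasoning.PartialOrder as PosetReasoning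

module DpBiKleeneAlgebraProperties {c : Level} (K : DpBiKleeneAlgebra c) where
  open DpBiKleeneAlgebra K

  ≤-reflexive : ∀ {x y} → x ≡ y → x ≤ y
  ≤-reflexive {x} refl = +-idem x

  ≤-trans : ∀ {x y z} → x ≤ y → y ≤ z → x ≤ z
  ≤-trans {x} {y} {z} x≤y y≤z = begin
    x + z        ≡⟨ cong (x +_) y≤z ⟨
    x + (y + z)  ≡⟨ +-assoc x y z ⟨
    (x + y) + z  ≡⟨ cong (_+ z) x≤y ⟩
    y + z        ≡⟨ y≤z ⟩
    z            ∎
    where open ≡-Reasoning

  ≤-antisym : ∀ {x y} → x ≤ y → y ≤ x → x ≡ y
  ≤-antisym {x} {y} x≤y y≤x = trans (sym y≤x) (trans (+-comm y x) x≤y)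

  ≤-isPartialOrder : IsPartialOrder _≡_ _≤_
  ≤-isPartialOrder = record
    { isPreorder = record
      { isEquivalence = isEquivalence
      ; reflexive = ≤-reflexive
      ; trans = ≤-trans
      }
    ; antisym = ≤-antisym
    }

  ≤-poset : Poset c c c
  ≤-poset = record { isPartialOrder = ≤-isPartialOrder }

  module ≤-Reasoning = PosetReasoning ≤-poset

  x≤x+y : ∀ x y → x ≤ x + y
  x≤x+y x y = trans (sym (+-assoc x x y)) (cong (_+ y) (+-idem x))

  y≤x+y : ∀ x y → y ≤ x + y
  y≤x+y x y = trans (cong (y +_) (+-comm x y)) (trans (x≤x+y y x) (+-comm y x))

  +-lub : ∀ {x y z} → x ≤ z → y ≤ z → x + y ≤ z
  +-lub {x} {y} {z} x≤z y≤z = trans (+-assoc x y z) (trans (cong (x +_) y≤z) x≤z)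

  ·-monoˡ : ∀ {x y} z → x ≤ y → x · z ≤ y · z
  ·-monoˡ {x} {y} z x≤y = trans (sym (·-distribʳ x y z)) (cong (_· z) x≤y)

  ·-monoʳ : ∀ x {y z} → y ≤ z → x · y ≤ x · z
  ·-monoʳ x {y} {z} y≤z = begin
    x · y          ≤⟨ x≤x+y (x · y) (x · z) ⟩
    x · y + x · z  ≤⟨ ·-subdistribˡ x y z ⟩
    x · (y + z)    ≡⟨ cong (x ·_) y≤z ⟩
    x · z          ∎
    where open ≤-Reasoning

  ≤1σ⇒·-deflationary : ∀ {s} x → s ≤ 1σ → s · x ≤ x
  ≤1σ⇒·-deflationary x s≤1 = ≤-trans (·-monoˡ x s≤1) (≤-reflexive (·-identityˡ x))

  d-mono : ∀ {x y} → x ≤ y → d x ≤ d y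
  d-mono {x} {y} x≤y = trans (sym (d-add x y)) (cong d x≤y)

  d≤⇒≤· : ∀ {x s} → d x ≤ s → x ≤ s · x
  d≤⇒≤· {x} dx≤s = ≤-trans (d-absorb x) (·-monoˡ x dx≤s)

  d-idem : ∀ x → d (d x) ≡ d x
  d-idem x = begin
    d (d x)        ≡⟨ cong d (·-identityˡ (d x)) ⟨
    d (1σ · d x)   ≡⟨ d-local 1σ x ⟨
    d (1σ · x)     ≡⟨ cong d (·-identityˡ x) ⟩
    d x            ∎
    where open ≡-Reasoning

  1σ≤⋆ : ∀ x → 1σ ≤ x ⋆
  1σ≤⋆ x = ≤-trans (x≤x+y 1σ (x · x ⋆)) (⋆-unfold x)

  x·⋆≤⋆ : ∀ x → x · x ⋆ ≤ x ⋆
  x·⋆≤⋆ x = ≤-trans (y≤x+y 1σ (x · x ⋆)) (⋆-unfold x)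

  ⟨⟩-monoˡ : ∀ {x y} p → x ≤ y → ⟨ x ⟩ p ≤ ⟨ y ⟩ p
  ⟨⟩-monoˡ p x≤y = d-mono (·-monoˡ p x≤y)

  ⟨⟩-monoʳ : ∀ x {p q} → p ≤ q → ⟨ x ⟩ p ≤ ⟨ x ⟩ q
  ⟨⟩-monoʳ x p≤q = d-mono (·-monoʳ x p≤q)

  ⟨⟩-idem : ∀ x p → d (⟨ x ⟩ p) ≡ ⟨ x ⟩ p
  ⟨⟩-idem x p = d-idem (x · p)

  ⟨1σ⟩ : ∀ p → ⟨ 1σ ⟩ p ≡ d p
  ⟨1σ⟩ p = cong d (·-identityˡ p)

  ⟨+⟩ : ∀ x y p → ⟨ x + y ⟩ p ≡ ⟨ x ⟩ p + ⟨ y ⟩ p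
  ⟨+⟩ x y p = trans (cong d (·-distribʳ x y p)) (d-add (x · p) (y · p))

  ⟨·⟩ : ∀ x y p → ⟨ x · y ⟩ p ≡ ⟨ x ⟩ ⟨ y ⟩ p
  ⟨·⟩ x y p = begin
    d ((x · y) · p)      ≡⟨ d-local (x · y) p ⟩
    d ((x · y) · d p)    ≡⟨ cong d (·-assoc-d₃ x y p) ⟨
    d (x · (y · d p))    ≡⟨ d-local x (y · d p) ⟩
    d (x · d (y · d p))  ≡⟨ cong (λ t → d (x · t)) (d-local y p) ⟨
    d (x · d (y · p))    ∎
    where open ≡-Reasoning

  ⟨d⟩ : ∀ p q → ⟨ d p ⟩ q ≡ d p · d q
  ⟨d⟩ p q = begin
    d (d p · q)          ≡⟨ d-local (d p) q ⟩
    d (d p · d q)        ≡⟨ cong d (d-∥-d p q) ⟨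
    d (d p ∥ d q)        ≡⟨ d-∥ (d p) (d q) ⟩
    d (d p) · d (d q)    ≡⟨ cong₂ _·_ (d-idem p) (d-idem q) ⟩
    d p · d q            ∎
    where open ≡-Reasoning

  ⟨d⟩-≤ : ∀ p q → ⟨ d p ⟩ q ≤ d p
  ⟨d⟩-≤ p q = begin
    ⟨ d p ⟩ q   ≡⟨ ⟨d⟩ p q ⟩
    d p · d q   ≤⟨ ·-monoʳ (d p) (d-sub-id q) ⟩
    d p · 1σ    ≡⟨ ·-identityʳ (d p) ⟩
    d p         ∎
    where open ≤-Reasoning

  ⟨∥⟩ : ∀ x y p → ⟨ x ∥ y ⟩ p ≡ ⟨ x ⟩ p · ⟨ y ⟩ p
  ⟨∥⟩ x y p = begin
    d ((x ∥ y) · p)              ≡⟨ d-local (x ∥ y) p ⟩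
    d ((x ∥ y) · d p)            ≡⟨ cong d (∥-·-d x y p) ⟩
    d ((x · d p) ∥ (y · d p))    ≡⟨ d-∥ (x · d p) (y · d p) ⟩
    d (x · d p) · d (y · d p)    ≡⟨ cong₂ _·_ (d-local x p) (d-local y p) ⟨
    d (x · p) · d (y · p)        ∎
    where open ≡-Reasoning

  ⟨⋆⟩-induct : ∀ x p q → d p + ⟨ x ⟩ q ≤ d q → ⟨ x ⋆ ⟩ p ≤ d q
  ⟨⋆⟩-induct x p q hyp = begin
    d (x ⋆ · p)      ≡⟨ d-local (x ⋆) p ⟩
    d w              ≤⟨ d-mono (⋆-induct x (b · w) p (+-lub a≤b·w x·b·w≤b·w)) ⟩
    ⟨ b ⟩ w          ≤⟨ ⟨d⟩-≤ q w ⟩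
    b                ∎
    where
    open ≤-Reasoning
    a b w : Carrier
    a = d p
    b = d q
    w = x ⋆ · a

    a≤b : a ≤ b
    a≤b = ≤-trans (x≤x+y a _) hyp

    ⟨x⟩b≤b : ⟨ x ⟩ b ≤ b
    ⟨x⟩b≤b = ≤-trans (≤-reflexive (sym (d-local x q))) (≤-trans (y≤x+y a _) hyp)

    a≤b·w : a ≤ b · w
    a≤b·w = begin
      a            ≤⟨ d≤⇒≤· (≤-trans (≤-reflexive (d-idem p)) a≤b) ⟩
      b · a        ≡⟨ cong (b ·_) (·-identityˡ a) ⟨
      b · (1σ · a) ≤⟨ ·-monoʳ b (·-monoˡ a (1σ≤⋆ x)) ⟩
      b · w        ∎

    x·w≤w : x · w ≤ w
    x·w≤w = ≤-trans (≤-reflexive (·-assoc-d₃ x (x ⋆) p)) (·-monoˡ a (x·⋆≤⋆ x))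

    x·b·w≤b·w : x · (b · w) ≤ b · w
    x·b·w≤b·w = begin
      x · (b · w)          ≡⟨ ·-assoc-d₂ x q w ⟩
      (x · b) · w          ≤⟨ ·-monoˡ w (d≤⇒≤· ⟨x⟩b≤b) ⟩
      (b · (x · b)) · w    ≡⟨ ·-assoc-d₁ q (x · b) w ⟨
      b · ((x · b) · w)    ≡⟨ cong (b ·_) (·-assoc-d₂ x q w) ⟨
      b · (x · (b · w))    ≤⟨ ·-monoʳ b (·-monoʳ x (≤1σ⇒·-deflationary w (d-sub-id q))) ⟩
      b · (x · w)          ≤⟨ ·-monoʳ b x·w≤w ⟩
      b · w                ∎

  ⟨⋆⟩-unfold-≤ : ∀ x p → d p + ⟨ x ⟩ ⟨ x ⋆ ⟩ p ≤ ⟨ x ⋆ ⟩ p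
  ⟨⋆⟩-unfold-≤ x p = +-lub
    (≤-trans (≤-reflexive (sym (⟨1σ⟩ p))) (⟨⟩-monoˡ p (1σ≤⋆ x)))
    (≤-trans (≤-reflexive (sym (⟨·⟩ x (x ⋆) p))) (⟨⟩-monoˡ p (x·⋆≤⋆ x)))

  ⟨⋆⟩-unfold : ∀ x p → d p + ⟨ x ⟩ ⟨ x ⋆ ⟩ p ≡ ⟨ x ⋆ ⟩ p
  ⟨⋆⟩-unfold x p =
    ≤-antisym (⟨⋆⟩-unfold-≤ x p) (≤-trans (⟨⋆⟩-induct x p r step) (≤-reflexive dr≡r))
    where
    r : Carrier
    r = d p + ⟨ x ⟩ ⟨ x ⋆ ⟩ p

    dr≡r : d r ≡ r
    dr≡r = trans (d-add (d p) _) (cong₂ _+_ (d-idem p) (⟨⟩-idem x _))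

    step : d p + ⟨ x ⟩ r ≤ d r
    step = begin
      d p + ⟨ x ⟩ r              ≤⟨ +-lub (x≤x+y (d p) _) (≤-trans ⟨x⟩r≤⟨x⟩⟨x⋆⟩p (y≤x+y (d p) _)) ⟩
      d p + ⟨ x ⟩ ⟨ x ⋆ ⟩ p      ≡⟨ dr≡r ⟨
      d r                        ∎
      where
      open ≤-Reasoning
      ⟨x⟩r≤⟨x⟩⟨x⋆⟩p : ⟨ x ⟩ r ≤ ⟨ x ⟩ ⟨ x ⋆ ⟩ p
      ⟨x⟩r≤⟨x⟩⟨x⋆⟩p = ⟨⟩-monoʳ x (⟨⋆⟩-unfold-≤ x p)

  ⟨⋆⟩-invariant : ∀ x p → ⟨ x ⟩ p ≤ d p → ⟨ x ⋆ ⟩ p ≤ d p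
  ⟨⋆⟩-invariant x p ⟨x⟩p≤dp = ⟨⋆⟩-induct x p p (+-lub (+-idem (d p)) ⟨x⟩p≤dp)

theorem10p12 : ∀ {c : Level} (K : DpBiKleeneAlgebra c) →
    let open DpBiKleeneAlgebra K in
    ∀ x y p q →
      (⟨ x + y ⟩ p ≡ ⟨ x ⟩ p + ⟨ y ⟩ p)
      × (⟨ x · y ⟩ p ≡ ⟨ x ⟩ (⟨ y ⟩ p))
      × (⟨ d p ⟩ q ≡ d p · d q)
      × (⟨ x ∥ y ⟩ p ≡ (⟨ x ⟩ p) · (⟨ y ⟩ p))
      × (d p + ⟨ x ⟩ (⟨ x ⋆ ⟩ p) ≡ ⟨ x ⋆ ⟩ p)
      × (⟨ x ⟩ p ≤ d p → ⟨ x ⋆ ⟩ p ≤ d p)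
theorem10p12 K x y p q =
  ⟨+⟩ x y p , ⟨·⟩ x y p , ⟨d⟩ p q , ⟨∥⟩ x y p , ⟨⋆⟩-unfold x p , ⟨⋆⟩-invariant x p
  where open DpBiKleeneAlgebraProperties K
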